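{- Let $n \in \mathbb{N}$ and let $\mathcal{F} \subseteq \mathcal{P}([n])$ be a nontrivial, union closed family such that $$\#\{F \in \mathcal{F}: 1 \in F\} \geq \#\{F \in \mathcal{F}: 2 \in F\} \geq \dots \geq \#\{F \in \mathcal{F}: n \in F\}.$$ Then for $k = n$, and (when $n \geq 2$) also for $k = n-1$, it holds $$\#\{F \in \mathcal{F}: k \in F\} \geq \frac{1}{2^{k-1}+1} \cdot \#\mathcal{F}.$$
   Context: $[n] = \{1,\dots,n\}$ and $\mathcal{P}([n])$ is its power set; $\#X$ denotes cardinality. A family $\mathcal{F} \subseteq \mathcal{P}([n])$ is nontrivial if $\bigcup_{F \in \mathcal{F}} F = [n]$, and union closed if $A, B \in \mathcal{F}$ implies $A \cup B \in \mathcal{F}$. -}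

module Defs where

open import Data.Nat using (ℕ; suc; _≤_)
open import Data.Fin using (Fin; toℕ)
open import Data.Fin.Subset using (Subset; _∈_; _∪_)
open import Data.List using (List; length; filter)
import Data.List.Membership.Propositional as LM
open import Data.List.Relation.Unary.Unique.Propositional using (Unique)
open import Data.Product using (_×_; ∃-syntax)
open import Relation.Binary.PropositionalEquality using (_≡_)
open import Data.Fin.Subset.Properties using (_∈?_)

-- A family of subsets of [n] is a duplicate-free list of subsets of Fin n.
-- Element i : Fin n represents the number (toℕ i + 1) ∈ [n].

count : ∀ {n} → Fin n → List (Subset n) → ℕ
count i 𝓕 = length (filter (i ∈?_) 𝓕)

UnionClosed : ∀ {n} → List (Subset n) → Set
UnionClosed 𝓕 = ∀ A B → A LM.∈ 𝓕 → B LM.∈ 𝓕 → (A ∪ B) LM.∈ 𝓕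

Nontrivial : ∀ {n} → List (Subset n) → Set
Nontrivial {n} 𝓕 = ∀ (i : Fin n) → ∃[ F ] (F LM.∈ 𝓕 × i ∈ F)

FrequencyOrdered : ∀ {n} → List (Subset n) → Set
FrequencyOrdered {n} 𝓕 = ∀ (i j : Fin n) → toℕ j ≡ suc (toℕ i) → count j 𝓕 ≤ count i 𝓕

{-# OPTIONS --safe #-}
module Submission where

-- Let c be the number of members containing k; c ≥ 1 by nontriviality. The members avoiding k
-- are distinct subsets of [n] ∖ {k}, so there are at most 2^(n-1) of them. For k = n this gives
-- #𝓕 ≤ c + 2^(k-1) ≤ (2^(k-1) + 1) c, and for k = n - 1 it suffices when c ≥ 2, as
-- 2^(n-1) = 2 · 2^(k-1). If k = n - 1 and c = 1, the ordering forces n into exactly one member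
-- as well; union closedness then makes every member avoiding k avoid n too, so these members
-- are subsets of [n] ∖ {k, n}, at most 2^(k-1) of them.

open import Defs
open import Data.Nat using (ℕ; suc; _+_; _*_; _^_; _≤_)
open import Data.Fin using (Fin; toℕ)
open import Data.Fin.Subset using (Subset)
open import Data.List using (List; length)
open import Data.List.Relation.Unary.Unique.Propositional using (Unique)
open import Relation.Binary.PropositionalEquality using (_≡_)
open import Data.Sum using (_⊎_)

open import Data.Nat using (_<_; _<?_; z≤n; s≤s; >-nonZero)
open import Data.Nat.Properties
  using ( +-suc; +-comm; +-identityʳ; +-mono-≤; +-monoʳ-≤; *-comm; *-identityˡ; *-distribʳ-+
        ; *-monoʳ-≤; m≤m*n; ^-monoʳ-≤; ≤-reflexive; ≤-trans; ≤-antisym; ≤-pred; ≮⇒≥; 1+n≢n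
        ; module ≤-Reasoning)
open import Data.Fin using (fromℕ<)
open import Data.Fin.Properties using (toℕ-fromℕ<)
open import Data.Fin.Subset using (Side; inside; outside; _∈_; _∉_; _⊆_; _∪_; _-_; ⊤; ∣_∣)
open import Data.Fin.Subset.Properties
  using (_∈?_; ∈⊤; ⊆⊤; ∣⊤∣≡n; drop-∷-⊆; x∈p∪q⁺; x∈p∧x≢y⇒x∈p-y; x∈p⇒∣p-x∣<∣p∣)
open import Data.Bool using (_≟_)
open import Data.Vec using ([]; _∷_; here)
open import Data.List using ([]; _∷_; filter)
open import Data.List.Relation.Unary.All as All using (All; []; _∷_)
open import Data.List.Relation.Unary.AllPairs using ([]; _∷_)
open import Data.List.Relation.Unary.Any using (here)
import Data.List.Relation.Unary.Unique.Propositional.Properties as Unique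
open import Data.List.Membership.Propositional using () renaming (_∈_ to _∈ₗ_)
open import Data.List.Membership.Propositional.Properties using (∈-filter⁺; ∈-filter⁻; ∈-length)
open import Data.Product using (_,_)
open import Data.Sum using (inj₁; inj₂; [_,_]′)
open import Function using (_∘_)
open import Relation.Nullary using (yes; no)
open import Relation.Unary using (Decidable)
open import Relation.Unary.Properties using (∁?)
open import Relation.Binary.PropositionalEquality using (_≢_; refl; sym; trans; cong; subst)

private
  variable
    n : ℕ

length-filter+filter∁ : ∀ {A : Set} {P : A → Set} (P? : Decidable P) xs →
  length xs ≡ length (filter P? xs) + length (filter (∁? P?) xs)
length-filter+filter∁ P? [] = refl
length-filter+filter∁ P? (x ∷ xs) with P? x
... | yes _ = cong suc (length-filter+filter∁ P? xs)
... | no _ = trans (cong suc (length-filter+filter∁ P? xs)) (sym (+-suc _ _))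

length≡1⇒∈-unique : ∀ {A : Set} {x y : A} {xs} → length xs ≡ 1 → x ∈ₗ xs → y ∈ₗ xs → x ≡ y
length≡1⇒∈-unique {xs = _ ∷ []} _ (here refl) (here refl) = refl

tailsWith : Side → List (Subset (suc n)) → List (Subset n)
tailsWith b [] = []
tailsWith b ((x ∷ A) ∷ 𝓐) with x ≟ b
... | yes _ = A ∷ tailsWith b 𝓐
... | no _ = tailsWith b 𝓐

length-tailsWith : (𝓐 : List (Subset (suc n))) →
  length 𝓐 ≡ length (tailsWith inside 𝓐) + length (tailsWith outside 𝓐)
length-tailsWith [] = refl
length-tailsWith ((inside ∷ _) ∷ 𝓐) = cong suc (length-tailsWith 𝓐)
length-tailsWith ((outside ∷ _) ∷ 𝓐) = trans (cong suc (length-tailsWith 𝓐)) (sym (+-suc _ _))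

All-tailsWith : ∀ {P : Subset (suc n) → Set} b {𝓐} → All P 𝓐 → All (P ∘ (b ∷_)) (tailsWith b 𝓐)
All-tailsWith b [] = []
All-tailsWith b {(x ∷ _) ∷ _} (p ∷ ps) with x ≟ b
... | yes refl = p ∷ All-tailsWith b ps
... | no _ = All-tailsWith b ps

Unique-tailsWith : ∀ b {𝓐 : List (Subset (suc n))} → Unique 𝓐 → Unique (tailsWith b 𝓐)
Unique-tailsWith b [] = []
Unique-tailsWith b {(x ∷ _) ∷ _} (p ∷ ps) with x ≟ b
... | yes refl = All.map (λ ≢ ≡ → ≢ (cong (b ∷_) ≡)) (All-tailsWith b p) ∷ Unique-tailsWith b ps
... | no _ = Unique-tailsWith b ps

length≤2^∣∣ : (S : Subset n) {𝓐 : List (Subset n)} → Unique 𝓐 → All (_⊆ S) 𝓐 → length 𝓐 ≤ 2 ^ ∣ S ∣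
length-tailsWith≤ : ∀ {s} (S : Subset n) {𝓐 : List (Subset (suc n))} → Unique 𝓐 → All (_⊆ s ∷ S) 𝓐 →
  ∀ b → length (tailsWith b 𝓐) ≤ 2 ^ ∣ S ∣

length≤2^∣∣ [] {[]} _ _ = z≤n
length≤2^∣∣ [] {_ ∷ []} _ _ = s≤s z≤n
length≤2^∣∣ [] {[] ∷ [] ∷ _} ((≢ ∷ _) ∷ _) _ with () ← ≢ refl
length≤2^∣∣ (inside ∷ S) {𝓐} u ⊆S = begin
  length 𝓐                                         ≡⟨ length-tailsWith 𝓐 ⟩
  length (tailsWith inside 𝓐) + length (tailsWith outside 𝓐)
                                                   ≤⟨ +-mono-≤ (length-tailsWith≤ S u ⊆S inside)
                                                               (length-tailsWith≤ S u ⊆S outside) ⟩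
  2 ^ ∣ S ∣ + 2 ^ ∣ S ∣                            ≡⟨ cong (2 ^ ∣ S ∣ +_) (sym (+-identityʳ _)) ⟩
  2 ^ ∣ inside ∷ S ∣                               ∎
  where open ≤-Reasoning
length≤2^∣∣ (outside ∷ S) {𝓐} u ⊆S = begin
  length 𝓐                                         ≡⟨ length-tailsWith 𝓐 ⟩
  length (tailsWith inside 𝓐) + length (tailsWith outside 𝓐)
                                                   ≡⟨ cong (_+ length (tailsWith outside 𝓐)) (no-inside (All-tailsWith inside ⊆S)) ⟩
  length (tailsWith outside 𝓐)                     ≤⟨ length-tailsWith≤ S u ⊆S outside ⟩
  2 ^ ∣ S ∣                                        ∎
  where
  open ≤-Reasoning
  no-inside : ∀ {𝓑} → All (λ A → inside ∷ A ⊆ outside ∷ S) 𝓑 → length 𝓑 ≡ 0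
  no-inside [] = refl
  no-inside (⊆ ∷ _) with () ← ⊆ here

length-tailsWith≤ S u ⊆S b = length≤2^∣∣ S (Unique-tailsWith b u) (All.map drop-∷-⊆ (All-tailsWith b ⊆S))

p⊆q∧x∉p⇒p⊆q-x : ∀ {p q : Subset n} {x} → p ⊆ q → x ∉ p → p ⊆ q - x
p⊆q∧x∉p⇒p⊆q-x p⊆q x∉p y∈p = x∈p∧x≢y⇒x∈p-y (p⊆q y∈p) λ { refl → x∉p y∈p }

∣⊤-x∣<n : (x : Fin n) → ∣ ⊤ - x ∣ < n
∣⊤-x∣<n {n} x = subst (∣ ⊤ - x ∣ <_) (∣⊤∣≡n n) (x∈p⇒∣p-x∣<∣p∣ {p = ⊤ {n}} ∈⊤)

avoiding : Fin n → List (Subset n) → List (Subset n)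
avoiding k = filter (∁? (k ∈?_))

length-avoiding≤2^∣∣ : ∀ {𝓕 : List (Subset n)} → Unique 𝓕 → (k : Fin n) (S : Subset n) →
  (∀ {A} → A ∈ₗ 𝓕 → k ∉ A → A ⊆ S) → length (avoiding k 𝓕) ≤ 2 ^ ∣ S ∣
length-avoiding≤2^∣∣ u k S ⊆S = length≤2^∣∣ S (Unique.filter⁺ (∁? (k ∈?_)) u)
  (All.tabulate λ A∈ → let A∈𝓕 , k∉A = ∈-filter⁻ (∁? (k ∈?_)) A∈ in ⊆S A∈𝓕 k∉A)

count>0 : ∀ {𝓕 : List (Subset n)} → Nontrivial 𝓕 → ∀ i → 0 < count i 𝓕
count>0 nt i with F , F∈𝓕 , i∈F ← nt i = ∈-length (∈-filter⁺ (i ∈?_) F∈𝓕 i∈F)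

count≡1⇒≡ : ∀ {𝓕 : List (Subset n)} {i A B} → count i 𝓕 ≡ 1 →
  A ∈ₗ 𝓕 → B ∈ₗ 𝓕 → i ∈ A → i ∈ B → A ≡ B
count≡1⇒≡ {i = i} c≡1 A∈ B∈ i∈A i∈B =
  length≡1⇒∈-unique c≡1 (∈-filter⁺ (i ∈?_) A∈ i∈A) (∈-filter⁺ (i ∈?_) B∈ i∈B)

count≡1⇒k∉⇒l∉ : ∀ {𝓕 : List (Subset n)} {k l A} → UnionClosed 𝓕 → Nontrivial 𝓕 →
  count k 𝓕 ≡ 1 → count l 𝓕 ≡ 1 → A ∈ₗ 𝓕 → k ∉ A → l ∉ A
count≡1⇒k∉⇒l∉ {k = k} {l} {A} uc nt ck≡1 cl≡1 A∈ k∉A l∈A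
  with B , B∈ , k∈B ← nt k = k∉A (subst (k ∈_) (sym A≡B) k∈B)
  where
  B≡A∪B : B ≡ A ∪ B
  B≡A∪B = count≡1⇒≡ ck≡1 B∈ (uc A B A∈ B∈) k∈B (x∈p∪q⁺ (inj₂ k∈B))
  A≡B : A ≡ B
  A≡B = count≡1⇒≡ cl≡1 A∈ B∈ l∈A (subst (l ∈_) (sym B≡A∪B) (x∈p∪q⁺ (inj₁ l∈A)))

length-avoiding≤2^[n-1] : ∀ {m} {𝓕 : List (Subset n)} → Unique 𝓕 → (k : Fin n) →
  suc m ≡ n → length (avoiding k 𝓕) ≤ 2 ^ m
length-avoiding≤2^[n-1] u k 1+m≡n = ≤-trans
  (length-avoiding≤2^∣∣ u k (⊤ - k) (λ _ → p⊆q∧x∉p⇒p⊆q-x ⊆⊤))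
  (^-monoʳ-≤ 2 (≤-pred (subst (∣ ⊤ - k ∣ <_) (sym 1+m≡n) (∣⊤-x∣<n k))))

avoiding-last : ∀ {𝓕 : List (Subset n)} → Unique 𝓕 → Nontrivial 𝓕 → (k : Fin n) →
  suc (toℕ k) ≡ n → length (avoiding k 𝓕) ≤ 2 ^ toℕ k * count k 𝓕
avoiding-last {𝓕 = 𝓕} u nt k n≡1+k = begin
  length (avoiding k 𝓕) ≤⟨ length-avoiding≤2^[n-1] u k n≡1+k ⟩
  2 ^ toℕ k             ≤⟨ m≤m*n (2 ^ toℕ k) (count k 𝓕) {{>-nonZero (count>0 nt k)}} ⟩
  2 ^ toℕ k * count k 𝓕 ∎
  where open ≤-Reasoning

avoiding-penultimate : ∀ {𝓕 : List (Subset n)} → Unique 𝓕 → Nontrivial 𝓕 → UnionClosed 𝓕 →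
  FrequencyOrdered 𝓕 → (k : Fin n) →
  suc (suc (toℕ k)) ≡ n → length (avoiding k 𝓕) ≤ 2 ^ toℕ k * count k 𝓕
avoiding-penultimate {n} {𝓕} u nt uc fo k n≡2+k with 1 <? count k 𝓕
... | yes 1<c = begin
  length (avoiding k 𝓕) ≤⟨ length-avoiding≤2^[n-1] u k n≡2+k ⟩
  2 ^ suc (toℕ k)       ≡⟨ *-comm 2 (2 ^ toℕ k) ⟩
  2 ^ toℕ k * 2         ≤⟨ *-monoʳ-≤ (2 ^ toℕ k) 1<c ⟩
  2 ^ toℕ k * count k 𝓕 ∎
  where open ≤-Reasoning
... | no 1≮c = begin
  length (avoiding k 𝓕) ≤⟨ length-avoiding≤2^∣∣ u k (⊤ - k - l) avoiding-k⇒⊆ ⟩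
  2 ^ ∣ ⊤ - k - l ∣     ≤⟨ ^-monoʳ-≤ 2 ∣⊤-k-l∣≤k ⟩
  2 ^ toℕ k             ≤⟨ m≤m*n (2 ^ toℕ k) (count k 𝓕) {{>-nonZero (count>0 nt k)}} ⟩
  2 ^ toℕ k * count k 𝓕 ∎
  where
  open ≤-Reasoning
  1+k<n : suc (toℕ k) < n
  1+k<n = ≤-reflexive n≡2+k
  l : Fin n
  l = fromℕ< 1+k<n
  l≢k : l ≢ k
  l≢k l≡k = 1+n≢n (trans (sym (toℕ-fromℕ< 1+k<n)) (cong toℕ l≡k))
  ck≡1 : count k 𝓕 ≡ 1
  ck≡1 = ≤-antisym (≮⇒≥ 1≮c) (count>0 nt k)
  cl≡1 : count l 𝓕 ≡ 1
  cl≡1 = ≤-antisym (≤-trans (fo k l (toℕ-fromℕ< 1+k<n)) (≤-reflexive ck≡1)) (count>0 nt l)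
  avoiding-k⇒⊆ : ∀ {A} → A ∈ₗ 𝓕 → k ∉ A → A ⊆ ⊤ - k - l
  avoiding-k⇒⊆ A∈ k∉A =
    p⊆q∧x∉p⇒p⊆q-x (p⊆q∧x∉p⇒p⊆q-x ⊆⊤ k∉A) (count≡1⇒k∉⇒l∉ uc nt ck≡1 cl≡1 A∈ k∉A)
  ∣⊤-k-l∣≤k : ∣ ⊤ - k - l ∣ ≤ toℕ k
  ∣⊤-k-l∣≤k = ≤-pred (≤-pred (≤-trans (s≤s (x∈p⇒∣p-x∣<∣p∣ (x∈p∧x≢y⇒x∈p-y ∈⊤ l≢k)))
                                       (subst (∣ ⊤ - k ∣ <_) (sym n≡2+k) (∣⊤-x∣<n k))))

theorem2p6 : (n : ℕ) (𝓕 : List (Subset n)) → Unique 𝓕 → Nontrivial 𝓕 → UnionClosed 𝓕 →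
    FrequencyOrdered 𝓕 → (k : Fin n) → (suc (toℕ k) ≡ n ⊎ suc (suc (toℕ k)) ≡ n) →
      length 𝓕 ≤ (2 ^ toℕ k + 1) * count k 𝓕
theorem2p6 n 𝓕 u nt uc fo k position = begin
  length 𝓕                              ≡⟨ length-filter+filter∁ (k ∈?_) 𝓕 ⟩
  c + length (avoiding k 𝓕)             ≤⟨ +-monoʳ-≤ c avoiding≤ ⟩
  c + 2 ^ toℕ k * c                     ≡⟨ +-comm c (2 ^ toℕ k * c) ⟩
  2 ^ toℕ k * c + c                     ≡⟨ cong (2 ^ toℕ k * c +_) (sym (*-identityˡ c)) ⟩
  2 ^ toℕ k * c + 1 * c                 ≡⟨ sym (*-distribʳ-+ c (2 ^ toℕ k) 1) ⟩
  (2 ^ toℕ k + 1) * c                   ∎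
  where
  open ≤-Reasoning
  c = count k 𝓕
  avoiding≤ : length (avoiding k 𝓕) ≤ 2 ^ toℕ k * c
  avoiding≤ = [ avoiding-last u nt k , avoiding-penultimate u nt uc fo k ]′ position
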